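{- Let $G$ be a connected interval graph with a representation as described in the context. Then $c_{\infty}(G) \le 3 w(G)$.
   Context: Cops and Robber game with a fast robber: played on a finite simple connected graph $G$. The cops first choose initial vertices (several may share a vertex), then the robber chooses a vertex. Players alternate rounds, cops first. Each cop stays or moves to an adjacent vertex; the robber may stay or move along any path from her current vertex containing no vertex occupied by a cop. The cops win if a cop moves onto the robber's vertex. $c_{\infty}(G)$ is the minimum number of cops guaranteeing a cop win. Let $G$ be represented by closed intervals $I_v$ ($v \in V(G)$) of positive length such that $u,v$ are adjacent iff $I_u \cap I_v \neq \emptyset$. Let $x_1 < \dots < x_{l+1}$ be the distinct endpoints, choose $y_i$ with $x_i < y_i < x_{i+1}$ ($1 \le i \le l$), and set $V_i = \{v : y_i \in I_v\}$. For $1 \le a \le b \le l$, $G[a,b]$ is the subgraph induced by $\bigcup_{a \le i \le b} V_i$ (an interval subgraph). For $A \subseteq V(G)$, $\overline{N}(A)$ is the set of vertices in $A$ or adjacent to a vertex of $A$. A subgraph $H$ is $k$-wide if (i) $H$ is $k$-connected and (ii) for every $S \subseteq V(G)$ with $|S| < k$, $V(H) \not\subseteq \overline{N}(S)$. $w(G)$ is the maximum $M$ such that $G$ has an $M$-wide interval subgraph. -}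

module Defs where

open import Data.Nat using (ℕ; _<_)
open import Data.Fin using (Fin)
open import Data.Fin.Subset using (Subset; _∈_; _∉_; ∣_∣)
open import Data.Rational as ℚ using (ℚ)
open import Data.Product using (Σ; ∃; ∃-syntax; _×_; _,_)
open import Data.Sum using (_⊎_)
open import Data.Unit using (⊤)
open import Relation.Nullary using (¬_)
open import Relation.Binary.PropositionalEquality using (_≡_; _≢_)
open import Function.Bundles using (_⇔_)

record Graph (n : ℕ) : Set₁ where
  field
    Adj   : Fin n → Fin n → Set
    sym   : ∀ {u v} → Adj u v → Adj v u
    irrefl : ∀ {u} → ¬ Adj u u

module _ {n : ℕ} (G : Graph n) where
  open Graph G

  data Reach (P : Fin n → Set) (u : Fin n) : Fin n → Set where
    here : P u → Reach P u u
    step : ∀ {v w} → Reach P u v → Adj v w → P w → Reach P u w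

  ConnectedOn : (Fin n → Set) → Set
  ConnectedOn P = (∃ λ v → P v) × (∀ u v → P u → P v → Reach P u v)

  ConnectedGraph : Set
  ConnectedGraph = ConnectedOn (λ _ → ⊤)

  KConnected : ℕ → (Fin n → Set) → Set
  KConnected k P = ∀ (S : Subset n) → (∀ v → v ∈ S → P v) → ∣ S ∣ < k →
                   ConnectedOn (λ v → P v × v ∉ S)

  InClosedNbhd : Subset n → Fin n → Set
  InClosedNbhd S v = v ∈ S ⊎ (∃ λ u → u ∈ S × Adj u v)

  Wide : ℕ → (Fin n → Set) → Set
  Wide k P = KConnected k P ×
             (∀ (S : Subset n) → ∣ S ∣ < k → ¬ (∀ v → P v → InClosedNbhd S v))

  CopMove : ∀ {k} → (Fin k → Fin n) → (Fin k → Fin n) → Set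
  CopMove cops cops' = ∀ i → cops' i ≡ cops i ⊎ Adj (cops i) (cops' i)

  RobberMove : ∀ {k} → (Fin k → Fin n) → Fin n → Fin n → Set
  RobberMove cops r r' = Reach (λ v → ∀ i → cops i ≢ v) r r'

  data CopWin {k : ℕ} (cops : Fin k → Fin n) (r : Fin n) : Set where
    win : (cops' : Fin k → Fin n) → CopMove cops cops' →
          ((∃ λ i → cops' i ≡ r) ⊎ (∀ r' → RobberMove cops' r r' → CopWin cops' r')) →
          CopWin cops r

  CopsWin : ℕ → Set
  CopsWin k = ∃ λ (cops₀ : Fin k → Fin n) → ∀ r → CopWin cops₀ r

record IntervalRep {n : ℕ} (G : Graph n) : Set where
  field
    l r   : Fin n → ℚ
    pos   : ∀ v → l v ℚ.< r v
    adj⇔  : ∀ u v → u ≢ v →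
            Graph.Adj G u v ⇔ (∃ λ q → (l u ℚ.≤ q × q ℚ.≤ r u) × (l v ℚ.≤ q × q ℚ.≤ r v))

module _ {n : ℕ} {G : Graph n} (R : IntervalRep G) where
  open IntervalRep R

  IsEndpoint : ℚ → Set
  IsEndpoint x = ∃ λ v → x ≡ l v ⊎ x ≡ r v

  -- s = x_i and t = x_{i+1} for some i
  Consecutive : ℚ → ℚ → Set
  Consecutive s t = IsEndpoint s × IsEndpoint t × s ℚ.< t ×
                    (∀ z → IsEndpoint z → ¬ (s ℚ.< z × z ℚ.< t))

  -- vertex set of G[a,b] where p = x_a, q = x_{b+1} (a ≤ b iff p < q):
  -- union of V_i = {v : y_i ∈ I_v} over the gaps (x_i , x_{i+1}) inside [p , q]
  InIntervalSub : ℚ → ℚ → Fin n → Set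
  InIntervalSub p q v = ∃ λ s → ∃ λ t → Consecutive s t × p ℚ.≤ s × t ℚ.≤ q ×
                        (∃ λ y → (s ℚ.< y × y ℚ.< t) × (l v ℚ.≤ y × y ℚ.≤ r v))

  HasWideIntervalSub : ℕ → Set
  HasWideIntervalSub k = ∃ λ p → ∃ λ q → IsEndpoint p × IsEndpoint q × p ℚ.< q ×
                         Wide G k (InIntervalSub p q)

  IsW : ℕ → Set
  IsW M = HasWideIntervalSub M × (∀ M' → HasWideIntervalSub M' → M' Data.Nat.≤ M)

module Submission where

-- Let M = w(G), and call the cut at q the set of vertices whose interval
-- contains q and continues to the right of q.  Three teams of M cops sweep
-- the line from left to right.  A phase at threshold s starts with the
-- robber strictly right of s and one team (the guard) on the cut at s, which
-- the robber cannot cross.  Let t be the first endpoint after s and s′ the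
-- first endpoint from t on whose cut has at most M vertices.  All cuts in
-- [t , s′) are larger, so G[t , s′] is (M+1)-connected; as w(G) = M it is not
-- (M+1)-wide, hence dominated by at most M vertices.  While the guard keeps
-- still, the other two teams walk to this dominating set and to the cut at
-- s′.  A robber whose interval starts before s′ is then next to a dominator,
-- one starting at s′ stands on a scout, and otherwise the next phase begins
-- at s′ with the scouts as guards.  Phases move through the finitely many
-- endpoints, so the cops win.

open import Defs
open import Data.Nat using (ℕ; _≤_; _*_)
open import Data.Product using (∃; _×_)

import Level
open import Data.Nat as ℕ using (zero; suc; _<_; z≤n; s≤s)
import Data.Nat.Properties as ℕP
open import Data.Nat.Induction using (<-wellFounded)
open import Data.Fin as Fin using (Fin; combine; remQuot)
open import Data.Fin.Properties using (any?; all?; remQuot-combine)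
open import Data.Fin.Subset using (Subset; _∈_; _∉_; _⊆_; ∣_∣; ⊥; Empty)
open import Data.Fin.Subset.Properties using (_∈?_; p⊆q⇒∣p∣≤∣q∣; anySubset?; Empty-unique; ∣⊥∣≡0)
open import Data.Bool using (true; false)
open import Data.Maybe as Maybe using (Maybe; just; nothing; fromMaybe)
open import Data.Vec as Vec using ([]; _∷_; tabulate)
open import Data.Vec.Properties using (lookup∘tabulate; []=⇒lookup; lookup⇒[]=)
open import Data.List as List using (List; []; _∷_; _++_; allFin)
open import Data.List.Membership.Propositional using () renaming (_∈_ to _∈ₗ_)
open import Data.List.Membership.Propositional.Properties using (∈-++⁺ˡ; ∈-++⁺ʳ; ∈-++⁻; ∈-map⁺; ∈-map⁻; ∈-allFin)
open import Data.List.Relation.Unary.Any using (here; there)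
open import Data.Rational as ℚ using (ℚ; _⊔_; 1ℚ)
import Data.Rational.Properties as ℚP
open import Data.Product using (Σ; _,_; proj₁; proj₂; uncurry)
open import Data.Sum as Sum using (_⊎_; inj₁; inj₂)
open import Data.Empty using (⊥-elim)
open import Data.Unit using (⊤; tt)
open import Function using (_∘_)
open import Function.Bundles using (Equivalence)
open import Induction.WellFounded using (WellFounded; Acc; acc; module Subrelation)
open import Relation.Binary.Core using (Rel)
open import Relation.Binary.Definitions using (Transitive; Total; Reflexive)
import Relation.Binary.Construct.On as On
open import Relation.Nullary using (¬_; Dec; yes; no; does)
open import Relation.Nullary.Decidable using (dec-true; map′; _×-dec_; _⊎-dec_; _→-dec_; ¬?)
open import Relation.Unary using (Pred; Decidable)
open import Relation.Binary.PropositionalEquality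

module Least {a ℓ p} {A : Set a} {_≼_ : Rel A ℓ}
             (≼-refl : Reflexive _≼_) (≼-trans : Transitive _≼_) (≼-total : Total _≼_)
             {P : Pred A p} (P? : Decidable P) where

  IsLeast : List A → A → Set (a Level.⊔ ℓ Level.⊔ p)
  IsLeast xs m = m ∈ₗ xs × P m × (∀ {x} → x ∈ₗ xs → P x → m ≼ x)

  least? : ∀ xs → (∀ {x} → x ∈ₗ xs → ¬ P x) ⊎ ∃ (IsLeast xs)
  least? [] = inj₁ λ ()
  least? (x ∷ xs) with P? x | least? xs
  ... | no ¬px | inj₁ none = inj₁ λ { (here refl) → ¬px ; (there x∈) → none x∈ }
  ... | no ¬px | inj₂ (m , m∈ , pm , m≤) =
    inj₂ (m , there m∈ , pm , λ { (here refl) px → ⊥-elim (¬px px) ; (there y∈) → m≤ y∈ })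
  ... | yes px | inj₁ none =
    inj₂ (x , here refl , px , λ { (here refl) _ → ≼-refl ; (there y∈) py → ⊥-elim (none y∈ py) })
  ... | yes px | inj₂ (m , m∈ , pm , m≤) with ≼-total x m
  ...   | inj₁ x≤m = inj₂ (x , here refl , px , λ { (here refl) _ → ≼-refl ; (there y∈) py → ≼-trans x≤m (m≤ y∈ py) })
  ...   | inj₂ m≤x = inj₂ (m , there m∈ , pm , λ { (here refl) _ → m≤x ; (there y∈) → m≤ y∈ })

  least : ∀ {xs x} → x ∈ₗ xs → P x → ∃ (IsLeast xs)
  least {xs} x∈ px with least? xs
  ... | inj₁ none = ⊥-elim (none x∈ px)
  ... | inj₂ m = m

-- Finite descent.  For a decidable strict order, "z is an element of the
-- list xs lying below e" is well founded: it strictly decreases the number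
-- of entries of xs below the current point.
module FiniteDescent {a ℓ} {A : Set a} {_≺_ : Rel A ℓ}
                     (≺-trans : Transitive _≺_) (≺-irrefl : ∀ {x} → ¬ x ≺ x)
                     (_≺?_ : ∀ x y → Dec (x ≺ y)) where

  below : List A → A → ℕ
  below [] e = 0
  below (x ∷ xs) e with x ≺? e
  ... | yes _ = suc (below xs e)
  ... | no _ = below xs e

  below-mono : ∀ xs {z e} → z ≺ e → below xs z ≤ below xs e
  below-mono [] z<e = z≤n
  below-mono (x ∷ xs) {z} {e} z<e with x ≺? z | x ≺? e
  ... | yes _ | yes _ = s≤s (below-mono xs z<e)
  ... | yes x<z | no x≮e = ⊥-elim (x≮e (≺-trans x<z z<e))
  ... | no _ | yes _ = ℕP.m≤n⇒m≤1+n (below-mono xs z<e)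
  ... | no _ | no _ = below-mono xs z<e

  below-strict : ∀ {xs z e} → z ∈ₗ xs → z ≺ e → below xs z < below xs e
  below-strict {x ∷ xs} {e = e} (here refl) x<e with x ≺? x | x ≺? e
  ... | yes x<x | _ = ⊥-elim (≺-irrefl x<x)
  ... | no _ | yes _ = s≤s (below-mono xs x<e)
  ... | no _ | no x≮e = ⊥-elim (x≮e x<e)
  below-strict {x ∷ xs} {z} {e} (there z∈) z<e with x ≺? z | x ≺? e
  ... | yes _ | yes _ = s≤s (below-strict z∈ z<e)
  ... | yes x<z | no x≮e = ⊥-elim (x≮e (≺-trans x<z z<e))
  ... | no _ | yes _ = ℕP.m<n⇒m<1+n (below-strict z∈ z<e)
  ... | no _ | no _ = below-strict z∈ z<e

  descent-wf : ∀ xs → WellFounded (λ z e → z ∈ₗ xs × z ≺ e)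
  descent-wf xs = Subrelation.wellFounded (λ (z∈ , z<e) → below-strict z∈ z<e)
                    (On.wellFounded (below xs) <-wellFounded)

module _ {n : ℕ} where

  subset : ∀ {p} {P : Pred (Fin n) p} → Decidable P → Subset n
  subset P? = tabulate (does ∘ P?)

  ∈-subset⁺ : ∀ {p} {P : Pred (Fin n) p} (P? : Decidable P) {v} → P v → v ∈ subset P?
  ∈-subset⁺ P? {v} pv = lookup⇒[]= v _ (trans (lookup∘tabulate _ v) (dec-true (P? v) pv))

  ∈-subset⁻ : ∀ {p} {P : Pred (Fin n) p} (P? : Decidable P) {v} → v ∈ subset P? → P v
  ∈-subset⁻ P? {v} v∈ with P? v | trans (sym (lookup∘tabulate (does ∘ P?) v)) ([]=⇒lookup v∈)
  ... | yes pv | _ = pv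
  ... | no _ | ()

  escape : (A S : Subset n) → ∣ S ∣ < ∣ A ∣ → ∃ λ v → v ∈ A × v ∉ S
  escape A S S<A with any? (λ v → (v ∈? A) ×-dec ¬? (v ∈? S))
  ... | yes (v , v∈A , v∉S) = v , v∈A , v∉S
  ... | no none = ⊥-elim (ℕP.<⇒≱ S<A (p⊆q⇒∣p∣≤∣q∣ A⊆S))
    where
    A⊆S : A ⊆ S
    A⊆S {v} v∈A with v ∈? S
    ... | yes v∈S = v∈S
    ... | no v∉S = ⊥-elim (none (v , v∈A , v∉S))

Covers : ∀ {n M} → (Fin M → Fin n) → Subset n → Set
Covers f S = ∀ v → v ∈ S → ∃ λ m → f m ≡ v

private
  enumerate′ : ∀ {n M} (S : Subset n) → ∣ S ∣ ≤ M →
               Σ (Fin M → Maybe (Fin n)) λ f → ∀ v → v ∈ S → ∃ λ m → f m ≡ just v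
  enumerate′ [] _ = (λ _ → nothing) , λ _ ()
  enumerate′ (false ∷ S) S≤M with enumerate′ S S≤M
  ... | f , covers = Maybe.map Fin.suc ∘ f
                   , λ { (Fin.suc v) (Vec.there v∈) → let m , eq = covers v v∈ in m , cong (Maybe.map Fin.suc) eq }
  enumerate′ {n} {suc M} (true ∷ S) (s≤s S≤M) with enumerate′ S S≤M
  ... | f , covers = g , λ { Fin.zero Vec.here → Fin.zero , refl
                           ; (Fin.suc v) (Vec.there v∈) → let m , eq = covers v v∈ in Fin.suc m , cong (Maybe.map Fin.suc) eq }
    where
    g : Fin (suc M) → Maybe (Fin n)
    g Fin.zero = just Fin.zero
    g (Fin.suc m) = Maybe.map Fin.suc (f m)

enumerate : ∀ {n M} (S : Subset n) → ∣ S ∣ ≤ M → Fin n → ∃ λ (f : Fin M → Fin n) → Covers f S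
enumerate S S≤M d with enumerate′ S S≤M
... | f , covers = fromMaybe d ∘ f , λ v v∈ → let m , eq = covers v v∈ in m , cong (fromMaybe d) eq

bounded : ∀ {k} (f : Fin k → ℕ) → ∃ λ N → ∀ i → f i ≤ N
bounded {zero} f = 0 , λ ()
bounded {suc k} f with bounded (f ∘ Fin.suc)
... | N , f≤N = f Fin.zero ℕ.⊔ N , λ { Fin.zero → ℕP.m≤m⊔n _ N ; (Fin.suc i) → ℕP.m≤n⇒m≤o⊔n (f Fin.zero) (f≤N i) }

module Pursuit {n : ℕ} (G : Graph n) where
  open Graph G renaming (sym to adj-sym)

  reach-end : ∀ {P u v} → Reach G P u v → P v
  reach-end (here pv) = pv
  reach-end (step _ _ pv) = pv

  _++ᴿ_ : ∀ {P u v w} → Reach G P u v → Reach G P v w → Reach G P u w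
  ρ ++ᴿ here _ = ρ
  ρ ++ᴿ step ρ′ vw pw = step (ρ ++ᴿ ρ′) vw pw

  reverseᴿ : ∀ {P u v} → Reach G P u v → Reach G P v u
  reverseᴿ (here pu) = here pu
  reverseᴿ (step ρ vw pw) = step (here pw) (adj-sym vw) (reach-end ρ) ++ᴿ reverseᴿ ρ

  mapᴿ : ∀ {P Q : Fin n → Set} → (∀ {v} → P v → Q v) → ∀ {u v} → Reach G P u v → Reach G Q u v
  mapᴿ f (here pu) = here (f pu)
  mapᴿ f (step ρ vw pw) = step (mapᴿ f ρ) vw (f pw)

  win-resp : ∀ {k} {c c′ : Fin k → Fin n} {r} → CopWin G c r → (∀ i → c′ i ≡ c i) → CopWin G c′ r
  win-resp {c = c} {c′} (win next move outcome) c′≗c = win next move′ outcome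
    where
    move′ : CopMove G c′ next
    move′ i rewrite c′≗c i = move i

  capture : ∀ {k} (c : Fin k → Fin n) r (i : Fin k) → c i ≡ r ⊎ Adj (c i) r → CopWin G c r
  capture {k} c r i near = win c′ move (inj₁ (i , c′-i))
    where
    c′ : Fin k → Fin n
    c′ j with j Fin.≟ i
    ... | yes _ = r
    ... | no _ = c j
    c′-i : c′ i ≡ r
    c′-i with i Fin.≟ i
    ... | yes _ = refl
    ... | no i≢i = ⊥-elim (i≢i refl)
    move : CopMove G c c′
    move j with j Fin.≟ i
    move j | yes refl = Sum.map₁ sym near
    move j | no _ = inj₁ refl

  capture-near : ∀ {k M} (c : Fin k → Fin n) (team : Fin M → Fin k) {D r} →
                 Covers (c ∘ team) D → InClosedNbhd G D r → CopWin G c r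
  capture-near c team covers (inj₁ r∈D) with covers _ r∈D
  ... | m , cop≡r = capture c _ (team m) (inj₁ cop≡r)
  capture-near c team covers (inj₂ (u , u∈D , u~r)) with covers u u∈D
  ... | m , cop≡u = capture c _ (team m) (inj₂ (subst (λ z → Adj z _) (sym cop≡u) u~r))

  length : ∀ {P u v} → Reach G P u v → ℕ
  length (here _) = 0
  length (step ρ _ _) = suc (length ρ)

  Route : ℕ → Fin n → Fin n → Set
  Route N t c = Σ (Reach G (λ _ → ⊤) t c) λ ρ → length ρ ≤ N

  route-zero : ∀ {t c} → Route 0 t c → c ≡ t
  route-zero (here _ , _) = refl

  record Advance (N : ℕ) (t c : Fin n) : Set where
    field
      next  : Fin n
      move  : next ≡ c ⊎ Adj c next
      route : Route N t next
      stays : c ≡ t → next ≡ c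

  advance : ∀ {N t c} → Route (suc N) t c → Advance N t c
  advance {t = t} {c} ρ with c Fin.≟ t
  ... | yes refl = record { next = c ; move = inj₁ refl ; route = here tt , z≤n ; stays = λ _ → refl }
  advance (here _ , _) | no c≢t = ⊥-elim (c≢t refl)
  advance (step ρ v~c _ , s≤s ρ≤N) | no c≢t =
    record { next = _ ; move = inj₂ (adj-sym v~c) ; route = ρ , ρ≤N ; stays = λ c≡t → ⊥-elim (c≢t c≡t) }

  -- The cops walk to a target configuration t from which they
  -- win against every robber position in X.  Meanwhile the cops guarding
  -- the fence F already stand on their targets and keep still; since X
  -- cannot be left without crossing F, the robber stays in X and the cops win.
  module Travel {k} (t : Fin k → Fin n) (F X : Fin n → Set)
                (confined : ∀ {r r′} → X r → Reach G (λ v → ¬ F v) r r′ → X r′)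
                (finish : ∀ r → X r → CopWin G t r) where

    Guarded : (Fin k → Fin n) → Set
    Guarded c = ∀ v → F v → ∃ λ i → t i ≡ v × c i ≡ t i

    travel : ∀ N (c : Fin k → Fin n) → (∀ i → Route N (t i) (c i)) → Guarded c →
             ∀ r → X r → CopWin G c r
    travel zero c routes guarded r xr = win-resp (finish r xr) (λ i → route-zero (routes i))
    travel (suc N) c routes guarded r xr =
      win c′ (λ i → Advance.move (advances i))
          (inj₂ λ r′ escape → travel N c′ (λ i → Advance.route (advances i)) guarded′ r′
                                (confined xr (mapᴿ avoids-F escape)))
      where
      advances : ∀ i → Advance N (t i) (c i)
      advances i = advance (routes i)
      c′ : Fin k → Fin n
      c′ i = Advance.next (advances i)
      guarded′ : Guarded c′
      guarded′ v fv with guarded v fv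
      ... | i , ti≡v , ci≡ti = i , ti≡v , trans (Advance.stays (advances i) ci≡ti) ci≡ti
      avoids-F : ∀ {v} → (∀ i → c′ i ≢ v) → ¬ F v
      avoids-F {v} free fv with guarded′ v fv
      ... | i , ti≡v , c′i≡ti = free i (trans c′i≡ti ti≡v)

<⇒≱ : ∀ {x y} → x ℚ.< y → ¬ y ℚ.≤ x
<⇒≱ x<y y≤x = ℚP.<-irrefl refl (ℚP.<-≤-trans x<y y≤x)

module Intervals {n : ℕ} {G : Graph n} (R : IntervalRep G) where
  open IntervalRep R
  open Graph G renaming (sym to adj-sym)

  Spans : Fin n → ℚ → Set
  Spans v q = l v ℚ.≤ q × q ℚ.≤ r v

  adj⇒meet : ∀ {u v} → Adj u v → ∃ λ q → Spans u q × Spans v q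
  adj⇒meet {u} {v} u~v with u Fin.≟ v
  ... | yes refl = ⊥-elim (irrefl u~v)
  ... | no u≢v = Equivalence.to (adj⇔ u v u≢v) u~v

  extend : ∀ {P : Fin n → Set} {u a w q} → Reach G P u a → P w → Spans a q → Spans w q → Reach G P u w
  extend {a = a} {w} ρ pw a∋q w∋q with a Fin.≟ w
  ... | yes refl = ρ
  ... | no a≢w = step ρ (Equivalence.from (adj⇔ a w a≢w) (_ , a∋q , w∋q)) pw

  meet? : ∀ u v → Dec (∃ λ q → Spans u q × Spans v q)
  meet? u v with l u ℚP.≤? r v | l v ℚP.≤? r u | l u ℚP.≤? l v
  ... | no lu≰rv | _ | _ = no λ (_ , (lu≤q , _) , (_ , q≤rv)) → lu≰rv (ℚP.≤-trans lu≤q q≤rv)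
  ... | yes _ | no lv≰ru | _ = no λ (_ , (_ , q≤ru) , (lv≤q , _)) → lv≰ru (ℚP.≤-trans lv≤q q≤ru)
  ... | yes _ | yes lv≤ru | yes lu≤lv = yes (l v , (lu≤lv , lv≤ru) , (ℚP.≤-refl , ℚP.<⇒≤ (pos v)))
  ... | yes lu≤rv | yes _ | no lu≰lv = yes (l u , (ℚP.≤-refl , ℚP.<⇒≤ (pos u)) , (ℚP.<⇒≤ (ℚP.≰⇒> lu≰lv) , lu≤rv))

  adjacent? : ∀ u v → Dec (Adj u v)
  adjacent? u v with u Fin.≟ v
  ... | yes refl = no irrefl
  ... | no u≢v = map′ (Equivalence.from (adj⇔ u v u≢v)) (Equivalence.to (adj⇔ u v u≢v)) (meet? u v)

  closedNbhd? : ∀ S v → Dec (InClosedNbhd G S v)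
  closedNbhd? S v = (v ∈? S) ⊎-dec any? (λ u → (u ∈? S) ×-dec adjacent? u v)

  endpoints : List ℚ
  endpoints = List.map l (allFin n) ++ List.map r (allFin n)

  ∈-endpoints : ∀ {x} → IsEndpoint R x → x ∈ₗ endpoints
  ∈-endpoints (v , inj₁ refl) = ∈-++⁺ˡ (∈-map⁺ l (∈-allFin v))
  ∈-endpoints (v , inj₂ refl) = ∈-++⁺ʳ (List.map l (allFin n)) (∈-map⁺ r (∈-allFin v))

  endpoint-∈ : ∀ {x} → x ∈ₗ endpoints → IsEndpoint R x
  endpoint-∈ x∈ with ∈-++⁻ (List.map l (allFin n)) x∈
  ... | inj₁ x∈ls = let v , _ , x≡lv = ∈-map⁻ l x∈ls in v , inj₁ x≡lv
  ... | inj₂ x∈rs = let v , _ , x≡rv = ∈-map⁻ r x∈rs in v , inj₂ x≡rv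

  left : ∀ v → IsEndpoint R (l v)
  left v = v , inj₁ refl

  right : ∀ v → IsEndpoint R (r v)
  right v = v , inj₂ refl

  least-endpoint : ∀ {P : ℚ → Set} → Decidable P → ∀ {x} → IsEndpoint R x → P x →
                   ∃ λ m → IsEndpoint R m × P m × (∀ {z} → IsEndpoint R z → P z → m ℚ.≤ z)
  least-endpoint P? ex px with Least.least ℚP.≤-refl ℚP.≤-trans ℚP.≤-total P? (∈-endpoints ex) px
  ... | m , m∈ , pm , m≤ = m , endpoint-∈ m∈ , pm , m≤ ∘ ∈-endpoints

  greatest-endpoint : ∀ {P : ℚ → Set} → Decidable P → ∀ {x} → IsEndpoint R x → P x →
                      ∃ λ m → IsEndpoint R m × P m × (∀ {z} → IsEndpoint R z → P z → z ℚ.≤ m)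
  greatest-endpoint P? ex px
    with Least.least ℚP.≤-refl (λ y≤x z≤y → ℚP.≤-trans z≤y y≤x) (λ x y → ℚP.≤-total y x) P? (∈-endpoints ex) px
  ... | m , m∈ , pm , m≥ = m , endpoint-∈ m∈ , pm , m≥ ∘ ∈-endpoints

  EndpointBelow EndpointAbove : ℚ → ℚ → Set
  EndpointBelow z e = IsEndpoint R z × z ℚ.< e
  EndpointAbove z e = IsEndpoint R z × e ℚ.< z

  descend-wf : WellFounded EndpointBelow
  descend-wf = Subrelation.wellFounded (λ (ez , z<e) → ∈-endpoints ez , z<e)
                 (FiniteDescent.descent-wf ℚP.<-trans (ℚP.<-irrefl refl) ℚP._<?_ endpoints)

  ascend-wf : WellFounded EndpointAbove
  ascend-wf = Subrelation.wellFounded (λ (ez , e<z) → ∈-endpoints ez , e<z)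
                (FiniteDescent.descent-wf (λ y<x z<y → ℚP.<-trans z<y y<x) (ℚP.<-irrefl refl)
                   (λ x y → y ℚP.<? x) endpoints)

  entry-endpoint : ∀ {a} v → IsEndpoint R a → IsEndpoint R (a ⊔ l v)
  entry-endpoint {a} v ea with ℚP.⊔-sel a (l v)
  ... | inj₁ eq = subst (IsEndpoint R) (sym eq) ea
  ... | inj₂ eq = subst (IsEndpoint R) (sym eq) (left v)

  entry-< : ∀ {a x} v → a ℚ.< x → l v ℚ.< x → a ⊔ l v ℚ.< x
  entry-< {a} v a<x lv<x with ℚP.⊔-sel a (l v)
  ... | inj₁ eq = subst (ℚ._< _) (sym eq) a<x
  ... | inj₂ eq = subst (ℚ._< _) (sym eq) lv<x

  Cut : ℚ → Fin n → Set
  Cut q v = l v ℚ.≤ q × q ℚ.< r v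

  cut? : ∀ q v → Dec (Cut q v)
  cut? q v = (l v ℚP.≤? q) ×-dec (q ℚP.<? r v)

  cut : ℚ → Subset n
  cut q = subset (cut? q)

  ∈-cut⁺ : ∀ {q v} → Cut q v → v ∈ cut q
  ∈-cut⁺ {q} = ∈-subset⁺ (cut? q)

  ∈-cut⁻ : ∀ {q v} → v ∈ cut q → Cut q v
  ∈-cut⁻ {q} = ∈-subset⁻ (cut? q)

  -- At the greatest endpoint the cut is empty, so every endpoint has a
  -- small cut at or to the right of it.
  empty-cut : ∀ {t} → IsEndpoint R t → ∃ λ e → IsEndpoint R e × t ℚ.≤ e × ∣ cut e ∣ ≡ 0
  empty-cut et with greatest-endpoint (λ _ → yes tt) et tt
  ... | top , etop , _ , top≥ = top , etop , top≥ et tt , trans (cong ∣_∣ (Empty-unique empty)) (∣⊥∣≡0 n)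
    where
    empty : Empty (cut top)
    empty (v , v∈cut) = <⇒≱ (proj₂ (∈-cut⁻ v∈cut)) (top≥ (right v) tt)

  cut⇒spans : ∀ {q v} → Cut q v → Spans v q
  cut⇒spans (lv≤q , q<rv) = lv≤q , ℚP.<⇒≤ q<rv

  confined : ∀ s {a b} → s ℚ.< l a → Reach G (λ v → ¬ Cut s v) a b → s ℚ.< l b
  confined s s<la (here _) = s<la
  confined s s<la (step {w = w} ρ v~w w∉cut) with l w ℚP.≤? s
  ... | no lw≰s = ℚP.≰⇒> lw≰s
  ... | yes lw≤s =
    let _ , (lv≤q , _) , (_ , q≤rw) = adj⇒meet v~w
    in ⊥-elim (w∉cut (lw≤s , ℚP.<-≤-trans (ℚP.<-≤-trans (confined s s<la ρ) lv≤q) q≤rw))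

  Meets : ℚ → ℚ → Fin n → Set
  Meets a b v = l v ℚ.< b × a ℚ.< r v

  meets? : ∀ a b v → Dec (Meets a b v)
  meets? a b v = (l v ℚP.<? b) ×-dec (a ℚP.<? r v)

  sub⇒meets : ∀ {a b v} → InIntervalSub R a b v → Meets a b v
  sub⇒meets (s , t , _ , a≤s , t≤b , y , (s<y , y<t) , (lv≤y , y≤rv)) =
    ℚP.≤-<-trans lv≤y (ℚP.<-≤-trans y<t t≤b) , ℚP.≤-<-trans a≤s (ℚP.<-≤-trans s<y y≤rv)

  -- Between endpoints a < b, the vertices of G[a,b] are exactly those whose
  -- interval meets (a , b): such an interval contains a gap (c , d) of
  -- consecutive endpoints starting at its entry point c into [a , ∞).
  meets⇒sub : ∀ {a b} → IsEndpoint R a → IsEndpoint R b → a ℚ.< b → ∀ {v} → Meets a b v → InIntervalSub R a b v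
  meets⇒sub {a} {b} ea eb a<b {v} (lv<b , a<rv) = gap (least-endpoint (c ℚP.<?_) eb c<b)
    where
    c : ℚ
    c = a ⊔ l v
    c<b : c ℚ.< b
    c<b = entry-< v a<b lv<b
    gap : (∃ λ d → IsEndpoint R d × c ℚ.< d × (∀ {z} → IsEndpoint R z → c ℚ.< z → d ℚ.≤ z)) → InIntervalSub R a b v
    gap (d , ed , c<d , d≤) =
      let y , c<y , y<d = ℚP.<-dense c<d in
      c , d , (entry-endpoint v ea , ed , c<d , λ z ez (c<z , z<d) → <⇒≱ z<d (d≤ ez c<z))
        , ℚP.p≤p⊔q a (l v) , d≤ eb c<b
        , y , (c<y , y<d)
        , ℚP.≤-trans (ℚP.p≤q⊔p a (l v)) (ℚP.<⇒≤ c<y)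
        , ℚP.≤-trans (ℚP.<⇒≤ y<d) (d≤ (right v) (entry-< v a<rv (pos v)))

module ThickBlock {n : ℕ} {G : Graph n} (R : IntervalRep G) (M : ℕ) {t s′ : ℚ}
                  (et : IsEndpoint R t) (es′ : IsEndpoint R s′) (t<s′ : t ℚ.< s′)
                  (thick : ∀ {e} → IsEndpoint R e → t ℚ.≤ e → e ℚ.< s′ → M < ∣ Intervals.cut R e ∣) where
  open IntervalRep R
  open Intervals R
  open Pursuit G

  Block : Fin n → Set
  Block = InIntervalSub R t s′

  module Survivors (S : Subset n) (S≤M : ∣ S ∣ ≤ M) where

    Alive : Fin n → Set
    Alive v = Block v × v ∉ S

    survivor : ∀ {e} → IsEndpoint R e → t ℚ.≤ e → e ℚ.< s′ → ∃ λ v → Cut e v × v ∉ S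
    survivor {e} ee t≤e e<s′ with escape (cut e) S (ℕP.≤-<-trans S≤M (thick ee t≤e e<s′))
    ... | v , v∈cut , v∉S = v , ∈-cut⁻ v∈cut , v∉S

    alive : ∀ {e v} → t ℚ.≤ e → e ℚ.< s′ → Cut e v → v ∉ S → Alive v
    alive t≤e e<s′ (lv≤e , e<rv) v∉S =
      meets⇒sub et es′ t<s′ (ℚP.≤-<-trans lv≤e e<s′ , ℚP.≤-<-trans t≤e e<rv) , v∉S

    root : Fin n
    root = proj₁ (survivor et ℚP.≤-refl t<s′)

    root-cut : Cut t root
    root-cut = proj₁ (proj₂ (survivor et ℚP.≤-refl t<s′))

    root-alive : Alive root
    root-alive = alive ℚP.≤-refl t<s′ root-cut (proj₂ (proj₂ (survivor et ℚP.≤-refl t<s′)))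

    -- Every survivor in a cut at e ∈ [t , s′) is reachable from the root,
    -- by induction on e: a survivor w′ of the cut at the previous endpoint p
    -- reaches past e, so its interval meets the one of w at e.
    reach-cut : ∀ e → Acc EndpointBelow e → t ℚ.≤ e → e ℚ.< s′ → ∀ {w} → Cut e w → w ∉ S → Reach G Alive root w
    reach-cut e (acc descend) t≤e e<s′ w∈cut w∉S with t ℚP.<? e
    ... | no t≮e with ℚP.≤-antisym t≤e (ℚP.≮⇒≥ t≮e)
    ...   | refl = extend (here root-alive) (alive t≤e e<s′ w∈cut w∉S) (cut⇒spans root-cut) (cut⇒spans w∈cut)
    reach-cut e (acc descend) t≤e e<s′ {w} w∈cut w∉S | yes t<e
      with greatest-endpoint (ℚP._<? e) et t<e
    ... | p , ep , p<e , p≥ = via (survivor ep t≤p p<s′)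
      where
      t≤p : t ℚ.≤ p
      t≤p = p≥ et t<e
      p<s′ : p ℚ.< s′
      p<s′ = ℚP.<-trans p<e e<s′
      via : (∃ λ w′ → Cut p w′ × w′ ∉ S) → Reach G Alive root w
      via (w′ , w′∈cut@(lw′≤p , p<rw′) , w′∉S) =
        extend (reach-cut p (descend (ep , p<e)) t≤p p<s′ w′∈cut w′∉S) (alive t≤e e<s′ w∈cut w∉S)
               (ℚP.≤-trans lw′≤p (ℚP.<⇒≤ p<e) , ℚP.≮⇒≥ λ rw′<e → <⇒≱ p<rw′ (p≥ (right w′) rw′<e))
               (cut⇒spans w∈cut)

    -- Every alive vertex u meets the cut at its entry point c into [t , ∞).
    reach-alive : ∀ {u} → Alive u → Reach G Alive root u
    reach-alive {u} u-alive@(u∈block , _) = via (survivor (entry-endpoint u et) (ℚP.p≤p⊔q t (l u)) c<s′)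
      where
      c : ℚ
      c = t ⊔ l u
      c<s′ : c ℚ.< s′
      c<s′ = entry-< u t<s′ (proj₁ (sub⇒meets u∈block))
      via : (∃ λ w → Cut c w × w ∉ S) → Reach G Alive root u
      via (w , w∈cut , w∉S) =
        extend (reach-cut c (descend-wf c) (ℚP.p≤p⊔q t (l u)) c<s′ w∈cut w∉S) u-alive (cut⇒spans w∈cut)
               (ℚP.p≤q⊔p t (l u) , ℚP.<⇒≤ (entry-< u (proj₂ (sub⇒meets u∈block)) (pos u)))

  kconnected : KConnected G (suc M) Block
  kconnected S _ S<suc-M = (root , root-alive) , λ u v u-alive v-alive →
    reverseᴿ (reach-alive u-alive) ++ᴿ reach-alive v-alive
    where open Survivors S (ℕP.≤-pred S<suc-M)

  dominated : (∀ M′ → HasWideIntervalSub R M′ → M′ ≤ M) →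
              ∃ λ D → ∣ D ∣ ≤ M × (∀ v → Meets t s′ v → InClosedNbhd G D v)
  dominated w≤M with anySubset? (λ D → (∣ D ∣ ℕP.≤? M) ×-dec all? (λ v → meets? t s′ v →-dec closedNbhd? D v))
  ... | yes D = D
  ... | no none = ⊥-elim (ℕP.<-irrefl refl (w≤M (suc M) (t , s′ , et , es′ , t<s′ , kconnected , undominated)))
    where
    undominated : ∀ S → ∣ S ∣ < suc M → ¬ (∀ v → Block v → InClosedNbhd G S v)
    undominated S S<suc-M dom = none (S , ℕP.≤-pred S<suc-M , λ v v-meets → dom v (meets⇒sub et es′ t<s′ v-meets))

module CopStrategy {n : ℕ} {G : Graph n} (R : IntervalRep G) (conn : ConnectedGraph G) (M : ℕ)
                   (w≤M : ∀ M′ → HasWideIntervalSub R M′ → M′ ≤ M) where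
  open IntervalRep R
  open Intervals R
  open Pursuit G

  -- The 3M cops form three teams of M.  In each phase one team guards the
  -- current cut, one dominates the next block and one occupies the next cut.
  data Role : Set where
    guard dominator scout : Role

  -- After a phase the scout becomes the guard and the two other teams are free again.
  promote demote : Role → Role
  promote scout = guard
  promote guard = dominator
  promote dominator = scout
  demote guard = scout
  demote dominator = guard
  demote scout = dominator

  promote-demote : ∀ ρ → promote (demote ρ) ≡ ρ
  promote-demote guard = refl
  promote-demote dominator = refl
  promote-demote scout = refl

  record Assignment : Set where
    field
      roleOf : Fin 3 → Role
      teamOf : Role → Fin 3
      role-team : ∀ ρ → roleOf (teamOf ρ) ≡ ρ
  open Assignment

  initial : Assignment
  initial = record
    { roleOf = λ { Fin.zero → guard ; (Fin.suc Fin.zero) → dominator ; (Fin.suc (Fin.suc Fin.zero)) → scout }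
    ; teamOf = λ { guard → Fin.zero ; dominator → Fin.suc Fin.zero ; scout → Fin.suc (Fin.suc Fin.zero) }
    ; role-team = λ { guard → refl ; dominator → refl ; scout → refl } }

  next : Assignment → Assignment
  next π = record
    { roleOf = promote ∘ roleOf π
    ; teamOf = teamOf π ∘ demote
    ; role-team = λ ρ → trans (cong promote (role-team π (demote ρ))) (promote-demote ρ) }

  Conf : Set
  Conf = Fin (3 * M) → Fin n

  team : Conf → Fin 3 → Fin M → Fin n
  team c j = c ∘ combine j

  assemble : (Fin 3 → Fin M → Fin n) → Conf
  assemble F i = uncurry F (remQuot M i)

  team-assemble : ∀ F j m → team (assemble F) j m ≡ F j m
  team-assemble F j m = cong (uncurry F) (remQuot-combine j m)

  Guards : Assignment → Conf → ℚ → Set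
  Guards π c s = Covers (team c (teamOf π guard)) (cut s)

  record Phase (s : ℚ) : Set where
    field
      s′ : ℚ
      es′ : IsEndpoint R s′
      s<s′ : s ℚ.< s′
      small : ∣ cut s′ ∣ ≤ M
      D : Subset n
      D≤M : ∣ D ∣ ≤ M
      dominates : ∀ v → s ℚ.< l v → l v ℚ.< s′ → InClosedNbhd G D v

  phase : ∀ s {x} → IsEndpoint R x → s ℚ.< x → Phase s
  phase s ex s<x with least-endpoint (s ℚP.<?_) ex s<x
  ... | t , et , s<t , t≤ with empty-cut et
  ...   | top , etop , t≤top , cut-top≡0
    with least-endpoint (λ e → (t ℚP.≤? e) ×-dec (∣ cut e ∣ ℕP.≤? M)) etop (t≤top , subst (_≤ M) (sym cut-top≡0) z≤n)
  ...     | s′ , es′ , (t≤s′ , small) , s′≤ = record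
    { s′ = s′ ; es′ = es′ ; s<s′ = ℚP.<-≤-trans s<t t≤s′ ; small = small
    ; D = proj₁ domination ; D≤M = proj₁ (proj₂ domination) ; dominates = proj₂ (proj₂ domination) }
    where
    thick : ∀ {e} → IsEndpoint R e → t ℚ.≤ e → e ℚ.< s′ → M < ∣ cut e ∣
    thick ee t≤e e<s′ = ℕP.≰⇒> λ small-e → <⇒≱ e<s′ (s′≤ ee (t≤e , small-e))
    dominate : Dec (t ℚ.< s′) → ∃ λ D → ∣ D ∣ ≤ M × (∀ v → s ℚ.< l v → l v ℚ.< s′ → InClosedNbhd G D v)
    dominate (yes t<s′) with ThickBlock.dominated R M et es′ t<s′ thick w≤M
    ... | D , D≤M , dom = D , D≤M , λ v s<lv lv<s′ → dom v (lv<s′ , ℚP.≤-<-trans (t≤ (left v) s<lv) (pos v))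
    dominate (no t≮s′) = ⊥ , subst (_≤ M) (sym (∣⊥∣≡0 n)) z≤n ,
                         λ v s<lv lv<s′ → ⊥-elim (t≮s′ (ℚP.≤-<-trans (t≤ (left v) s<lv) lv<s′))
    domination : ∃ λ D → ∣ D ∣ ≤ M × (∀ v → s ℚ.< l v → l v ℚ.< s′ → InClosedNbhd G D v)
    domination = dominate (t ℚP.<? s′)

  -- The guard stays on the cut at s, which confines the robber to
  -- the right of s; the other teams travel to the dominating set and to the
  -- cut at s′.  Then a robber starting before s′ is caught, and otherwise the
  -- next phase starts at s′ with the scouts as guards.
  sweep : ∀ s → Acc EndpointAbove s → ∀ π c → Guards π c s → ∀ x → s ℚ.< l x → CopWin G c x
  -- (The phase geometry is abstracted by 'with' so that its definition, which
  -- computes with rationals, is never unfolded while checking the strategy.)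
  sweep s (acc ascend) π c guards x s<lx with phase s (left x) s<lx
  ... | geometry = travel (proj₁ bound) c routes guarded x s<lx
    where
    open Phase geometry
    jobs : Role → Fin M → Fin n
    jobs guard = team c (teamOf π guard)
    jobs dominator = proj₁ (enumerate D D≤M x)
    jobs scout = proj₁ (enumerate (cut s′) small x)
    target : Conf
    target = assemble (jobs ∘ roleOf π)
    staffed : ∀ ρ m → team target (teamOf π ρ) m ≡ jobs ρ m
    staffed ρ m = trans (team-assemble (jobs ∘ roleOf π) (teamOf π ρ) m) (cong (λ ρ′ → jobs ρ′ m) (role-team π ρ))
    covers : ∀ ρ {S} → Covers (jobs ρ) S → Covers (team target (teamOf π ρ)) S
    covers ρ cov v v∈S with cov v v∈S
    ... | m , job≡v = m , trans (staffed ρ m) job≡v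
    finish : ∀ y → s ℚ.< l y → CopWin G target y
    finish y s<ly with l y ℚP.<? s′ | s′ ℚP.<? l y
    ... | yes ly<s′ | _ = capture-near target (combine (teamOf π dominator))
                            (covers dominator (proj₂ (enumerate D D≤M x))) (dominates y s<ly ly<s′)
    ... | no _ | yes s′<ly = sweep s′ (ascend (es′ , s<s′)) (next π) target
                               (covers scout (proj₂ (enumerate (cut s′) small x))) y s′<ly
    ... | no ly≮s′ | no s′≮ly = capture-near target (combine (teamOf π scout))
                                  (covers scout (proj₂ (enumerate (cut s′) small x)))
                                  (inj₁ (∈-cut⁺ (ℚP.≮⇒≥ s′≮ly , ℚP.≤-<-trans (ℚP.≮⇒≥ ly≮s′) (pos y))))
    open Travel target (Cut s) (λ y → s ℚ.< l y) (confined s) finish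
    walks : ∀ i → Reach G (λ _ → ⊤) (target i) (c i)
    walks i = proj₂ conn (target i) (c i) tt tt
    bound : ∃ λ N → ∀ i → length (walks i) ≤ N
    bound = bounded (λ i → length (walks i))
    routes : ∀ i → Route (proj₁ bound) (target i) (c i)
    routes i = walks i , proj₂ bound i
    guarded : Guarded c
    guarded v v∈cut with guards v (∈-cut⁺ v∈cut)
    ... | m , cop≡v = combine (teamOf π guard) m , trans (staffed guard m) cop≡v , sym (staffed guard m)

  v₀ : Fin n
  v₀ = proj₁ (proj₁ conn)

  -- Start with every cop on v₀ and the threshold below all endpoints, where
  -- the cut is empty and nothing needs guarding.

  cops-win : CopsWin G (3 * M)
  cops-win with least-endpoint (λ _ → yes tt) (left v₀) tt
  ... | e₀ , _ , _ , e₀≤ = (λ _ → v₀) , λ x → sweep s₀ (ascend-wf s₀) initial (λ _ → v₀) nothing-to-guard x (below x)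
    where
    s₀ : ℚ
    s₀ = e₀ ℚ.- 1ℚ
    s₀<e₀ : s₀ ℚ.< e₀
    s₀<e₀ = subst (s₀ ℚ.<_) (ℚP.+-identityʳ e₀) (ℚP.+-mono-≤-< (ℚP.≤-refl {e₀}) (ℚP.negative⁻¹ (ℚ.- 1ℚ)))
    below : ∀ v → s₀ ℚ.< l v
    below v = ℚP.<-≤-trans s₀<e₀ (e₀≤ (left v) tt)
    nothing-to-guard : Guards initial (λ _ → v₀) s₀
    nothing-to-guard v v∈cut = ⊥-elim (<⇒≱ (below v) (proj₁ (∈-cut⁻ v∈cut)))

lemma2p6 : ∀ {n} (G : Graph n) (R : IntervalRep G) → ConnectedGraph G →
           ∀ M → IsW R M → ∃ λ k → k ≤ 3 * M × CopsWin G k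
lemma2p6 G R conn M (_ , w≤M) = 3 * M , ℕP.≤-refl , CopStrategy.cops-win R conn M w≤M
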